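{- Let $G$ and $H$ be finite, simple, connected graphs, each with at least two vertices. Then $2\le h(G\boxtimes H)\le h(G)\,h(H)$. Furthermore, both bounds are sharp, i.e. each of the two inequalities holds with equality for some such pair of graphs $G,H$.
   Context: For a connected graph $G$, the closed interval $I[x,y]$ consists of $x$, $y$ and all vertices on some shortest $x$–$y$ path; for $S\subseteq V(G)$, $I[S]=\bigcup_{u,v\in S}I[u,v]$. Set $I^0[S]=S$ and $I^i[S]=I[I^{i-1}[S]]$ for $i\ge1$. A set is convex if $I[S]=S$; the convex hull $CH(S)$ is the smallest convex set containing $S$ (equivalently $CH(S)=I^r[S]$ for some $r\ge 0$). $S$ is a hull set if $CH(S)=V(G)$; the hull number $h(G)$ is the minimum cardinality of a hull set. The strong product $G\boxtimes H$ has vertex set $V(G)\times V(H)$, with $(g,h)$ and $(g',h')$ adjacent whenever ($g=g'$ and $hh'\in E(H)$), or ($h=h'$ and $gg'\in E(G)$), or ($gg'\in E(G)$ and $hh'\in E(H)$). -}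

module Defs where

open import Data.Nat using (ℕ; zero; suc; _≤_; _<_; _*_)
open import Data.Bool using (Bool; true; false; _∧_; _∨_)
open import Data.Fin using (Fin; remQuot)
open import Data.Fin.Properties using (_≟_)
open import Data.Fin.Subset using (Subset; _∈_; _⊆_; ∣_∣)
open import Data.Product using (Σ; ∃; _×_; _,_; proj₁; proj₂)
open import Relation.Nullary using (¬_; does; yes; no)
open import Data.Empty using (⊥-elim)
open import Relation.Binary.PropositionalEquality using (_≡_; refl)
import Relation.Binary.PropositionalEquality as ≡

record Graph : Set where
  field
    n      : ℕ
    adj    : Fin n → Fin n → Bool
    sym    : ∀ x y → adj x y ≡ adj y x
    irrefl : ∀ x → adj x x ≡ false

open Graph public

module _ (G : Graph) where

  V : Set
  V = Fin (n G)

  data Walk : V → V → ℕ → Set where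
    nil  : ∀ {x} → Walk x x 0
    cons : ∀ {x y z k} → adj G x y ≡ true → Walk y z k → Walk x z (suc k)

  data OnWalk (z : V) : ∀ {x y k} → Walk x y k → Set where
    here  : ∀ {y k} {w : Walk z y k} → OnWalk z w
    there : ∀ {x u y k} {e : adj G x u ≡ true} {w : Walk u y k} →
            OnWalk z w → OnWalk z (cons {x} e w)

  Connected : Set
  Connected = ∀ x y → ∃ λ k → Walk x y k

  -- A shortest x–y path: a walk of length k such that no x–y walk is shorter.
  -- (Shortest walks are paths.)
  IsShortest : ∀ {x y k} → Walk x y k → Set
  IsShortest {x} {y} {k} _ = ∀ k′ → k′ < k → ¬ Walk x y k′

  -- z ∈ I[x,y]: z lies on some shortest x–y path (this includes x and y).
  InInterval : V → V → V → Set
  InInterval x y z = Σ ℕ λ k → Σ (Walk x y k) λ w → IsShortest w × OnWalk z w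

  -- T is convex: I[T] = T (i.e. I[T] ⊆ T; T ⊆ I[T] holds always).
  Convex : Subset (n G) → Set
  Convex T = ∀ x y z → x ∈ T → y ∈ T → InInterval x y z → z ∈ T

  -- S is a hull set: CH(S) = V(G), i.e. the smallest convex set containing S
  -- is all of V(G); equivalently every convex set containing S is V(G).
  HullSet : Subset (n G) → Set
  HullSet S = ∀ T → Convex T → S ⊆ T → ∀ v → v ∈ T

  IsHullNumber : ℕ → Set
  IsHullNumber k = (Σ (Subset (n G)) λ S → HullSet S × ∣ S ∣ ≡ k)
                 × (∀ S → HullSet S → k ≤ ∣ S ∣)

_⊠_ : Graph → Graph → Graph
G ⊠ H = record
  { n = n G * n H
  ; adj = λ p q → sadj (remQuot (n H) p) (remQuot (n H) q)
  ; sym = λ p q → ssym (remQuot (n H) p) (remQuot (n H) q)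
  ; irrefl = λ p → sirr (remQuot (n H) p)
  }
  where
  eqb : ∀ {m} → Fin m → Fin m → Bool
  eqb a b = does (a ≟ b)
  sadj : Fin (n G) × Fin (n H) → Fin (n G) × Fin (n H) → Bool
  sadj (g , h) (g′ , h′) =
       (eqb g g′ ∧ adj H h h′)
    ∨ ((eqb h h′ ∧ adj G g g′)
    ∨  (adj G g g′ ∧ adj H h h′))
  eqb-sym : ∀ {m} (a b : Fin m) → eqb a b ≡ eqb b a
  eqb-sym a b with a ≟ b | b ≟ a
  ... | yes _ | yes _ = refl
  ... | no _  | no _  = refl
  ... | yes p | no q  = ⊥-elim (q (≡.sym p))
  ... | no p  | yes q = ⊥-elim (p (≡.sym q))
  eqb-refl : ∀ {m} (a : Fin m) → eqb a a ≡ true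
  eqb-refl a with a ≟ a
  ... | yes _ = refl
  ... | no ¬p = ⊥-elim (¬p refl)
  ssym : ∀ a b → sadj a b ≡ sadj b a
  ssym (g , h) (g′ , h′)
    rewrite eqb-sym g g′ | eqb-sym h h′ | Graph.sym G g g′ | Graph.sym H h h′ = refl
  sirr : ∀ a → sadj a a ≡ false
  sirr (g , h) rewrite eqb-refl g | eqb-refl h | irrefl G g | irrefl H h = refl

module Submission where

-- A set with fewer than two vertices is trivially convex, and a
-- hull set that is itself convex must be the whole vertex set; hence, once the
-- graph has at least two vertices, every hull set has at least two elements.
--
-- If S₁, S₂ are hull sets of G, H then S₁ × S₂ is a hull set of
-- G ⊠ H.  The key tool is a retraction principle: if X sits inside P via an
-- adjacency-preserving map ι that has a non-expanding left inverse π, then ι is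
-- distance-preserving, so the ι-preimage of a convex set of P is convex in X.
-- Every G-layer G × {h} and H-layer {g} × H of G ⊠ H is such a retract.  So a
-- convex T ⊇ S₁ × S₂ contains each layer G × {h} with h ∈ S₂ (its trace on the
-- layer is convex and contains S₁), and then every layer {g} × H (its trace
-- contains {g} × S₂), i.e. all of G ⊠ H.
--
-- In a complete graph every set is convex, so h(Kₙ) = n; with
-- K₂ ⊠ K₂ = K₄ this gives h(K₂ ⊠ K₂) = 4 = h(K₂) h(K₂).  In C₄ ⊠ K₂ two
-- suitable antipodal vertices already form a hull set, so h(C₄ ⊠ K₂) = 2.

open import Defs hiding (sym)
open import Data.Nat using (ℕ; suc; _≤_; _<_; _+_; _*_; z≤n; s≤s; _≤?_)
open import Data.Nat.Properties using (≤-refl; ≤-trans; ≰⇒>; <⇒≱; ≤-<-trans; <-≤-trans; m≤n⇒m≤1+n; *-mono-≤)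
open import Data.Bool using (Bool; true; false; _∧_; _∨_; not; if_then_else_; _xor_)
open import Data.Bool.Properties using (∨-zeroʳ)
open import Data.Fin using (Fin; zero; suc; combine; remQuot; #_)
open import Data.Fin.Properties using (_≟_; remQuot-combine; combine-remQuot)
open import Data.Fin.Subset using (Subset; _∈_; _⊆_; ∣_∣; ⊤; ⊥; ⁅_⁆; _-_; inside; outside)
open import Data.Fin.Subset.Properties
  using (∈⊤; ∣⊤∣≡n; ∣⊥∣≡0; ∣⁅x⁆∣≡1; x∈⁅y⁆⇒x≡y; p⊆q⇒∣p∣≤∣q∣; x∈p∧x≢y⇒x∈p-y; x∈p⇒∣p-x∣<∣p∣)
open import Data.Vec using ([]; _∷_; _++_; map; concat; lookup; tabulate; here; there)
open import Data.Vec.Properties using ([]=⇒lookup; lookup⇒[]=; lookup∘tabulate; lookup-concat; lookup-map)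
open import Data.Product using (Σ; _×_; _,_; proj₁; proj₂; uncurry)
open import Data.Sum using (_⊎_; inj₁; inj₂; map₁)
open import Data.Empty using (⊥-elim)
open import Relation.Nullary using (¬_; does; yes; no)
open import Relation.Nullary.Decidable using (dec-true; dec-false)
open import Relation.Binary.PropositionalEquality
  using (_≡_; _≢_; refl; sym; trans; cong; cong₂; subst; subst₂; module ≡-Reasoning)

module _ {G : Graph} where

  walk-length-0 : ∀ {x y} → Walk G x y 0 → x ≡ y
  walk-length-0 nil = refl

  onWalk-length-0 : ∀ {x y z} (w : Walk G x y 0) → OnWalk G z w → z ≡ x
  onWalk-length-0 nil here = refl

  interval-trivial : ∀ {x z} → InInterval G x x z → z ≡ x
  interval-trivial (0 , w , _ , on) = onWalk-length-0 w on
  interval-trivial (suc k , _ , shortest , _) = ⊥-elim (shortest 0 (s≤s z≤n) nil)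

  interval-adjacent : ∀ {x y z} → adj G x y ≡ true → InInterval G x y z → z ≡ x ⊎ z ≡ y
  interval-adjacent e (0 , w , _ , on) = inj₁ (onWalk-length-0 w on)
  interval-adjacent e (1 , cons _ nil , _ , here) = inj₁ refl
  interval-adjacent e (1 , cons _ nil , _ , there here) = inj₂ refl
  interval-adjacent e (suc (suc k) , _ , shortest , _) =
    ⊥-elim (shortest 1 (s≤s (s≤s z≤n)) (cons e nil))

  commonNeighbour∈interval : ∀ {x m y} → adj G x m ≡ true → adj G m y ≡ true →
    x ≢ y → adj G x y ≡ false → InInterval G x y m
  commonNeighbour∈interval {x} {m} {y} xm my x≢y nonadj =
    2 , cons xm (cons my nil) , noShorter , there here
    where
    noShorter : ∀ k → k < 2 → ¬ Walk G x y k
    noShorter 0 _ w = x≢y (walk-length-0 w)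
    noShorter 1 _ (cons e nil) with trans (sym e) nonadj
    ... | ()
    noShorter (suc (suc k)) (s≤s (s≤s ())) _

two-members : ∀ {m} (S : Subset m) {x y} → x ∈ S → y ∈ S → x ≢ y → 2 ≤ ∣ S ∣
two-members S {x} {y} x∈S y∈S x≢y =
  <-≤-trans (s≤s nonempty) (x∈p⇒∣p-x∣<∣p∣ x∈S)
  where
  nonempty : 1 ≤ ∣ S - x ∣
  nonempty = subst (_≤ ∣ S - x ∣) (∣⁅x⁆∣≡1 y) (p⊆q⇒∣p∣≤∣q∣ singleton⊆)
    where
    singleton⊆ : ⁅ y ⁆ ⊆ S - x
    singleton⊆ z∈ with x∈⁅y⁆⇒x≡y y z∈
    ... | refl = x∈p∧x≢y⇒x∈p-y y∈S (λ y≡x → x≢y (sym y≡x))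

module _ (G : Graph) where

  convex-hullSet-size : ∀ S → HullSet G S → Convex G S → n G ≤ ∣ S ∣
  convex-hullSet-size S hull convex =
    subst (_≤ ∣ S ∣) (∣⊤∣≡n (n G)) (p⊆q⇒∣p∣≤∣q∣ {p = ⊤} (λ {v} _ → hull S convex (λ v∈S → v∈S) v))

  -- A set with at most one vertex is convex: its only intervals are I[x,x] = {x}.
  small-convex : ∀ S → ∣ S ∣ < 2 → Convex G S
  small-convex S small x y z x∈S y∈S z∈I with x ≟ y
  ... | yes refl = subst (_∈ S) (sym (interval-trivial z∈I)) x∈S
  ... | no x≢y = ⊥-elim (<⇒≱ small (two-members S x∈S y∈S x≢y))

  hullSet-lower : 2 ≤ n G → ∀ S → HullSet G S → 2 ≤ ∣ S ∣
  hullSet-lower two≤n S hull with 2 ≤? ∣ S ∣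
  ... | yes two≤∣S∣ = two≤∣S∣
  ... | no two≰∣S∣ = ⊥-elim (<⇒≱ (<-≤-trans small two≤n) n≤∣S∣)
    where
    small : ∣ S ∣ < 2
    small = ≰⇒> two≰∣S∣
    n≤∣S∣ : n G ≤ ∣ S ∣
    n≤∣S∣ = convex-hullSet-size S hull (small-convex S small)

Complete : Graph → Set
Complete G = ∀ x y → x ≢ y → adj G x y ≡ true

module _ (G : Graph) (complete : Complete G) where

  -- In a complete graph every interval I[x,y] is {x, y}, so every set is convex.
  complete-convex : ∀ T → Convex G T
  complete-convex T x y z x∈T y∈T z∈I with x ≟ y
  ... | yes refl = subst (_∈ T) (sym (interval-trivial z∈I)) x∈T
  ... | no x≢y with interval-adjacent (complete x y x≢y) z∈I
  ...   | inj₁ refl = x∈T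
  ...   | inj₂ refl = y∈T

  complete-hullNumber : IsHullNumber G (n G)
  complete-hullNumber =
    (⊤ , (λ T _ ⊤⊆T v → ⊤⊆T ∈⊤) , ∣⊤∣≡n (n G)) ,
    λ S hull → convex-hullSet-size G S hull (complete-convex S)

  complete-connected : Connected G
  complete-connected x y with x ≟ y
  ... | yes refl = 0 , nil
  ... | no x≢y = 1 , cons (complete x y x≢y) nil

-- Walks map along both ι and π without getting longer, so ι preserves
-- distances and shortest paths; consequently the ι-preimage ("trace") of a
-- convex set of P is convex in X.
module Retraction (X P : Graph) (π : V P → V X) (ι : V X → V P)
  (π-nonexpanding : ∀ p q → adj P p q ≡ true → π p ≡ π q ⊎ adj X (π p) (π q) ≡ true)
  (ι-adj : ∀ x y → adj X x y ≡ true → adj P (ι x) (ι y) ≡ true)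
  (π∘ι : ∀ x → π (ι x) ≡ x) where

  project : ∀ {p q k} → Walk P p q k → Σ ℕ λ k′ → k′ ≤ k × Walk X (π p) (π q) k′
  project nil = 0 , z≤n , nil
  project (cons {p} {u} {q} e w) with project w | π-nonexpanding p u e
  ... | k′ , k′≤k , w′ | inj₁ πp≡πu =
    k′ , m≤n⇒m≤1+n k′≤k , subst (λ a → Walk X a (π q) k′) (sym πp≡πu) w′
  ... | k′ , k′≤k , w′ | inj₂ e′ = suc k′ , s≤s k′≤k , cons e′ w′

  embed : ∀ {x y k} → Walk X x y k → Walk P (ι x) (ι y) k
  embed nil = nil
  embed (cons e w) = cons (ι-adj _ _ e) (embed w)

  embed-on : ∀ {z x y k} (w : Walk X x y k) → OnWalk X z w → OnWalk P (ι z) (embed w)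
  embed-on w here = here
  embed-on (cons e w) (there on) = there (embed-on w on)

  -- The image of a shortest walk is shortest: a shorter walk in P would
  -- project to a shorter walk in X.
  embed-shortest : ∀ {x y k} (w : Walk X x y k) → IsShortest X w → IsShortest P (embed w)
  embed-shortest {x} {y} w shortest k′ k′<k w′ with project w′
  ... | k″ , k″≤k′ , w″ =
    shortest k″ (≤-<-trans k″≤k′ k′<k) (subst₂ (λ a b → Walk X a b k″) (π∘ι x) (π∘ι y) w″)

  embed-interval : ∀ {x y z} → InInterval X x y z → InInterval P (ι x) (ι y) (ι z)
  embed-interval (k , w , shortest , on) = k , embed w , embed-shortest w shortest , embed-on w on

  trace : Subset (n P) → Subset (n X)
  trace T = tabulate (λ x → lookup T (ι x))

  trace⁻ : ∀ T {x} → x ∈ trace T → ι x ∈ T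
  trace⁻ T {x} x∈ = lookup⇒[]= (ι x) T (trans (sym (lookup∘tabulate _ x)) ([]=⇒lookup x∈))

  trace⁺ : ∀ T {x} → ι x ∈ T → x ∈ trace T
  trace⁺ T {x} ιx∈ = lookup⇒[]= x (trace T) (trans (lookup∘tabulate _ x) ([]=⇒lookup ιx∈))

  trace-convex : ∀ T → Convex P T → Convex X (trace T)
  trace-convex T convex x y z x∈ y∈ z∈I =
    trace⁺ T (convex (ι x) (ι y) (ι z) (trace⁻ T x∈) (trace⁻ T y∈) (embed-interval z∈I))

  hullSet-image : ∀ S → HullSet X S → ∀ T → Convex P T → (∀ {x} → x ∈ S → ι x ∈ T) →
    ∀ x → ι x ∈ T
  hullSet-image S hull T convex S⊆ x =
    trace⁻ T (hull (trace T) (trace-convex T convex) (λ x∈S → trace⁺ T (S⊆ x∈S)) x)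

strongAdj-coordinates : ∀ eg aH eh aG → (eg ∧ aH) ∨ ((eh ∧ aG) ∨ (aG ∧ aH)) ≡ true →
  (eg ≡ true ⊎ aG ≡ true) × (eh ≡ true ⊎ aH ≡ true)
strongAdj-coordinates eg true eh true _ = inj₂ refl , inj₂ refl
strongAdj-coordinates true true eh false _ = inj₁ refl , inj₂ refl
strongAdj-coordinates false true true false ()
strongAdj-coordinates false true false false ()
strongAdj-coordinates eg false true true _ = inj₂ refl , inj₁ refl
strongAdj-coordinates true false false true ()
strongAdj-coordinates false false false true ()
strongAdj-coordinates true false true false ()
strongAdj-coordinates true false false false ()
strongAdj-coordinates false false true false ()
strongAdj-coordinates false false false false ()

≟-sound : ∀ {m} {a b : Fin m} → does (a ≟ b) ≡ true → a ≡ b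
≟-sound {a = a} {b} e with a ≟ b
≟-sound _  | yes a≡b = a≡b
≟-sound () | no _

module StrongProduct (G H : Graph) where

  π₁ : V (G ⊠ H) → V G
  π₁ p = proj₁ (remQuot {n G} (n H) p)

  π₂ : V (G ⊠ H) → V H
  π₂ p = proj₂ (remQuot {n G} (n H) p)

  strongAdj : V G × V H → V G × V H → Bool
  strongAdj (g , h) (g′ , h′) =
       (does (g ≟ g′) ∧ adj H h h′)
    ∨ ((does (h ≟ h′) ∧ adj G g g′)
    ∨  (adj G g g′ ∧ adj H h h′))

  adj-combine : ∀ g h g′ h′ → adj (G ⊠ H) (combine g h) (combine g′ h′) ≡ strongAdj (g , h) (g′ , h′)
  adj-combine g h g′ h′ = cong₂ strongAdj (remQuot-combine g h) (remQuot-combine g′ h′)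

  strongAdj-moves : ∀ a b → strongAdj a b ≡ true →
    (proj₁ a ≡ proj₁ b ⊎ adj G (proj₁ a) (proj₁ b) ≡ true) ×
    (proj₂ a ≡ proj₂ b ⊎ adj H (proj₂ a) (proj₂ b) ≡ true)
  strongAdj-moves (g , h) (g′ , h′) e with strongAdj-coordinates _ _ _ _ e
  ... | moves₁ , moves₂ = map₁ ≟-sound moves₁ , map₁ ≟-sound moves₂

  π₁-nonexpanding : ∀ p q → adj (G ⊠ H) p q ≡ true → π₁ p ≡ π₁ q ⊎ adj G (π₁ p) (π₁ q) ≡ true
  π₁-nonexpanding p q e = proj₁ (strongAdj-moves (remQuot (n H) p) (remQuot (n H) q) e)

  π₂-nonexpanding : ∀ p q → adj (G ⊠ H) p q ≡ true → π₂ p ≡ π₂ q ⊎ adj H (π₂ p) (π₂ q) ≡ true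
  π₂-nonexpanding p q e = proj₂ (strongAdj-moves (remQuot (n H) p) (remQuot (n H) q) e)

  -- The layers G × {h} and {g} × H are adjacency-preserving copies of G and H;
  -- with the non-expanding projections π₁, π₂ they are retracts of G ⊠ H.
  layer₁-adj : ∀ h g g′ → adj G g g′ ≡ true → adj (G ⊠ H) (combine g h) (combine g′ h) ≡ true
  layer₁-adj h g g′ e rewrite adj-combine g h g′ h | dec-true (h ≟ h) refl | e = ∨-zeroʳ _

  layer₂-adj : ∀ g h h′ → adj H h h′ ≡ true → adj (G ⊠ H) (combine g h) (combine g h′) ≡ true
  layer₂-adj g h h′ e rewrite adj-combine g h g h′ | dec-true (g ≟ g) refl | e = refl

  module Layer₁ (h : V H) = Retraction G (G ⊠ H) π₁ (λ g → combine g h) π₁-nonexpanding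
    (layer₁-adj h) (λ g → cong proj₁ (remQuot-combine g h))

  module Layer₂ (g : V G) = Retraction H (G ⊠ H) π₂ (combine g) π₂-nonexpanding
    (layer₂-adj g) (λ h → cong proj₂ (remQuot-combine g h))

  strongAdj-complete : Complete G → Complete H → ∀ a b → a ≢ b → strongAdj a b ≡ true
  strongAdj-complete cG cH (g , h) (g′ , h′) a≢b with g ≟ g′ | h ≟ h′
  ... | yes refl | yes refl = ⊥-elim (a≢b refl)
  ... | yes refl | no h≢h′ rewrite cH h h′ h≢h′ = refl
  ... | no g≢g′ | yes refl rewrite cG g g′ g≢g′ = refl
  ... | no g≢g′ | no h≢h′ rewrite cG g g′ g≢g′ | cH h h′ h≢h′ = refl

  ⊠-complete : Complete G → Complete H → Complete (G ⊠ H)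
  ⊠-complete cG cH p q p≢q =
    strongAdj-complete cG cH (remQuot (n H) p) (remQuot (n H) q) (λ eq → p≢q (decode-injective eq))
    where
    decode-injective : remQuot {n G} (n H) p ≡ remQuot (n H) q → p ≡ q
    decode-injective eq = begin
      p                                        ≡⟨ sym (combine-remQuot {n G} (n H) p) ⟩
      uncurry combine (remQuot {n G} (n H) p) ≡⟨ cong (uncurry combine) eq ⟩
      uncurry combine (remQuot {n G} (n H) q) ≡⟨ combine-remQuot {n G} (n H) q ⟩
      q                                        ∎
      where open ≡-Reasoning

-- The product S × T of vertex sets, as a subset of Fin (m * k) under `combine`.
_×ˢ_ : ∀ {m k} → Subset m → Subset k → Subset (m * k)
S ×ˢ T = concat (map (λ b → if b then T else ⊥) S)

∈-×ˢ : ∀ {m k} {S : Subset m} {T : Subset k} {g h} → g ∈ S → h ∈ T → combine g h ∈ S ×ˢ T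
∈-×ˢ {S = S} {T} {g} {h} g∈S h∈T = lookup⇒[]= (combine g h) (S ×ˢ T) (begin
  lookup (S ×ˢ T) (combine g h)        ≡⟨ lookup-concat (map row S) g h ⟩
  lookup (lookup (map row S) g) h      ≡⟨ cong (λ r → lookup r h) (lookup-map g row S) ⟩
  lookup (row (lookup S g)) h          ≡⟨ cong (λ b → lookup (row b) h) ([]=⇒lookup g∈S) ⟩
  lookup T h                           ≡⟨ []=⇒lookup h∈T ⟩
  inside                               ∎)
  where
  open ≡-Reasoning
  row : Bool → Subset _
  row b = if b then T else ⊥

∣++∣ : ∀ {m k} (xs : Subset m) (ys : Subset k) → ∣ xs ++ ys ∣ ≡ ∣ xs ∣ + ∣ ys ∣
∣++∣ [] ys = refl
∣++∣ (inside ∷ xs) ys = cong suc (∣++∣ xs ys)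
∣++∣ (outside ∷ xs) ys = ∣++∣ xs ys

∣×ˢ∣ : ∀ {m k} (S : Subset m) (T : Subset k) → ∣ S ×ˢ T ∣ ≡ ∣ S ∣ * ∣ T ∣
∣×ˢ∣ [] T = refl
∣×ˢ∣ (inside ∷ S) T = trans (∣++∣ T (S ×ˢ T)) (cong (∣ T ∣ +_) (∣×ˢ∣ S T))
∣×ˢ∣ {k = k} (outside ∷ S) T = trans (∣++∣ (⊥ {n = k}) (S ×ˢ T)) (cong₂ _+_ (∣⊥∣≡0 k) (∣×ˢ∣ S T))

-- A convex T ⊇ S₁ × S₂ contains every G-layer G × {h} with h ∈ S₂, hence
-- contains {g} × S₂ for all g, hence every H-layer {g} × H.
×ˢ-hullSet : (G H : Graph) (S₁ : Subset (n G)) (S₂ : Subset (n H)) →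
  HullSet G S₁ → HullSet H S₂ → HullSet (G ⊠ H) (S₁ ×ˢ S₂)
×ˢ-hullSet G H S₁ S₂ hull₁ hull₂ T convex S⊆T v =
  subst (_∈ T) (combine-remQuot {n G} (n H) v) (everything (π₁ v) (π₂ v))
  where
  open StrongProduct G H
  G-layers : ∀ {h} → h ∈ S₂ → ∀ g → combine g h ∈ T
  G-layers {h} h∈S₂ = Layer₁.hullSet-image h S₁ hull₁ T convex (λ g∈S₁ → S⊆T (∈-×ˢ g∈S₁ h∈S₂))
  everything : ∀ g h → combine g h ∈ T
  everything g = Layer₂.hullSet-image g S₂ hull₂ T convex (λ h∈S₂ → G-layers h∈S₂ g)

K : ℕ → Graph
K m = record { n = m ; adj = λ x y → not (does (x ≟ y)) ; sym = K-sym ; irrefl = K-irrefl }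
  where
  K-sym : ∀ x y → not (does (x ≟ y)) ≡ not (does (y ≟ x))
  K-sym x y with x ≟ y | y ≟ x
  ... | yes _ | yes _ = refl
  ... | no _ | no _ = refl
  ... | yes x≡y | no y≢x = ⊥-elim (y≢x (sym x≡y))
  ... | no x≢y | yes y≡x = ⊥-elim (x≢y (sym y≡x))
  K-irrefl : ∀ x → not (does (x ≟ x)) ≡ false
  K-irrefl x = cong not (dec-true (x ≟ x) refl)

K-complete : ∀ m → Complete (K m)
K-complete m x y x≢y = cong not (dec-false (x ≟ y) x≢y)

-- The 4-cycle 0–1–2–3–0: even and odd vertices are exactly the adjacent pairs.
parity : Fin 4 → Bool
parity zero = false
parity (suc zero) = true
parity (suc (suc zero)) = false
parity (suc (suc (suc zero))) = true

C₄ : Graph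
C₄ = record { n = 4 ; adj = λ x y → parity x xor parity y ; sym = C₄-sym ; irrefl = C₄-irrefl }
  where
  C₄-sym : ∀ x y → parity x xor parity y ≡ parity y xor parity x
  C₄-sym x y with parity x | parity y
  ... | true | true = refl
  ... | true | false = refl
  ... | false | true = refl
  ... | false | false = refl
  C₄-irrefl : ∀ x → parity x xor parity x ≡ false
  C₄-irrefl x with parity x
  ... | true = refl
  ... | false = refl

C₄-connected : Connected C₄
C₄-connected x y = _ , through (proj₂ (to-1 x)) (cons refl (proj₂ (from-0 y)))
  where
  through : ∀ {x y z k l} → Walk C₄ x y k → Walk C₄ y z l → Walk C₄ x z (k + l)
  through nil w = w
  through (cons e v) w = cons e (through v w)
  to-1 : ∀ x → Σ ℕ (Walk C₄ x (# 1))
  to-1 zero = _ , cons refl nil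
  to-1 (suc zero) = _ , nil
  to-1 (suc (suc zero)) = _ , cons refl nil
  to-1 (suc (suc (suc zero))) = _ , cons {y = # 0} refl (cons refl nil)
  from-0 : ∀ y → Σ ℕ (Walk C₄ (# 0) y)
  from-0 zero = _ , nil
  from-0 (suc zero) = _ , cons refl nil
  from-0 (suc (suc zero)) = _ , cons {y = # 1} refl (cons refl nil)
  from-0 (suc (suc (suc zero))) = _ , cons refl nil

-- In C₄ ⊠ K₂ (vertex (g , h) numbered 2g + h) the two vertices (0,0) and
-- (2,1) form a hull set: their interval contains (1,·) and (3,·), and the
-- interval of (1,0) and (3,1) contains the remaining (0,1) and (2,0).
C₄⊠K₂ : Graph
C₄⊠K₂ = C₄ ⊠ K 2

antipodes : Subset 8
antipodes = inside ∷ outside ∷ outside ∷ outside ∷ outside ∷ inside ∷ outside ∷ outside ∷ []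

antipodes-hullSet : HullSet C₄⊠K₂ antipodes
antipodes-hullSet T convex antipodes⊆T = all
  where
  between : ∀ x m y → x ∈ T → y ∈ T → adj C₄⊠K₂ x m ≡ true → adj C₄⊠K₂ m y ≡ true →
    x ≢ y → adj C₄⊠K₂ x y ≡ false → m ∈ T
  between x m y x∈T y∈T xm my x≢y nonadj =
    convex x y m x∈T y∈T (commonNeighbour∈interval xm my x≢y nonadj)
  t0 : # 0 ∈ T
  t0 = antipodes⊆T here
  t5 : # 5 ∈ T
  t5 = antipodes⊆T (there (there (there (there (there here)))))
  t2 : # 2 ∈ T
  t2 = between (# 0) (# 2) (# 5) t0 t5 refl refl (λ ()) refl
  t3 : # 3 ∈ T
  t3 = between (# 0) (# 3) (# 5) t0 t5 refl refl (λ ()) refl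
  t6 : # 6 ∈ T
  t6 = between (# 0) (# 6) (# 5) t0 t5 refl refl (λ ()) refl
  t7 : # 7 ∈ T
  t7 = between (# 0) (# 7) (# 5) t0 t5 refl refl (λ ()) refl
  t1 : # 1 ∈ T
  t1 = between (# 2) (# 1) (# 7) t2 t7 refl refl (λ ()) refl
  t4 : # 4 ∈ T
  t4 = between (# 2) (# 4) (# 7) t2 t7 refl refl (λ ()) refl
  all : ∀ v → v ∈ T
  all zero = t0
  all (suc zero) = t1
  all (suc (suc zero)) = t2
  all (suc (suc (suc zero))) = t3
  all (suc (suc (suc (suc zero)))) = t4
  all (suc (suc (suc (suc (suc zero))))) = t5
  all (suc (suc (suc (suc (suc (suc zero)))))) = t6
  all (suc (suc (suc (suc (suc (suc (suc zero))))))) = t7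

C₄⊠K₂-hullNumber : IsHullNumber C₄⊠K₂ 2
C₄⊠K₂-hullNumber = (antipodes , antipodes-hullSet , refl) , hullSet-lower C₄⊠K₂ (s≤s (s≤s z≤n))

hullNumber-bounds : (G H : Graph) → 2 ≤ n G → 2 ≤ n H → Connected G → Connected H →
  (a b c : ℕ) → IsHullNumber G a → IsHullNumber H b → IsHullNumber (G ⊠ H) c →
  (2 ≤ c) × (c ≤ a * b)
hullNumber-bounds G H two≤G two≤H _ _ a b c ((S₁ , hull₁ , ∣S₁∣≡a) , _)
  ((S₂ , hull₂ , ∣S₂∣≡b) , _) ((S , hull , ∣S∣≡c) , minimal) =
  subst (2 ≤_) ∣S∣≡c (hullSet-lower (G ⊠ H) two≤GH S hull) ,
  subst (c ≤_) (trans (∣×ˢ∣ S₁ S₂) (cong₂ _*_ ∣S₁∣≡a ∣S₂∣≡b))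
    (minimal (S₁ ×ˢ S₂) (×ˢ-hullSet G H S₁ S₂ hull₁ hull₂))
  where
  two≤GH : 2 ≤ n G * n H
  two≤GH = ≤-trans (s≤s (s≤s z≤n)) (*-mono-≤ two≤G two≤H)

lower-bound-sharp : Σ Graph λ G → Σ Graph λ H →
  (2 ≤ n G) × (2 ≤ n H) × Connected G × Connected H × IsHullNumber (G ⊠ H) 2
lower-bound-sharp = C₄ , K 2 , s≤s (s≤s z≤n) , ≤-refl , C₄-connected ,
  complete-connected (K 2) (K-complete 2) , C₄⊠K₂-hullNumber

upper-bound-sharp : Σ Graph λ G → Σ Graph λ H → Σ ℕ λ a → Σ ℕ λ b →
  (2 ≤ n G) × (2 ≤ n H) × Connected G × Connected H ×
  IsHullNumber G a × IsHullNumber H b × IsHullNumber (G ⊠ H) (a * b)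
upper-bound-sharp = K 2 , K 2 , 2 , 2 , ≤-refl , ≤-refl , K₂-connected , K₂-connected ,
  K₂-hullNumber , K₂-hullNumber , complete-hullNumber (K 2 ⊠ K 2) K₂⊠K₂-complete
  where
  K₂-connected : Connected (K 2)
  K₂-connected = complete-connected (K 2) (K-complete 2)
  K₂-hullNumber : IsHullNumber (K 2) 2
  K₂-hullNumber = complete-hullNumber (K 2) (K-complete 2)
  K₂⊠K₂-complete : Complete (K 2 ⊠ K 2)
  K₂⊠K₂-complete = StrongProduct.⊠-complete (K 2) (K 2) (K-complete 2) (K-complete 2)

theorem2 : ((G H : Graph) → 2 ≤ n G → 2 ≤ n H → Connected G → Connected H →
    (a b c : ℕ) → IsHullNumber G a → IsHullNumber H b → IsHullNumber (G ⊠ H) c →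
    (2 ≤ c) × (c ≤ a * b))
    × (Σ Graph λ G → Σ Graph λ H →
    (2 ≤ n G) × (2 ≤ n H) × Connected G × Connected H × IsHullNumber (G ⊠ H) 2)
    × (Σ Graph λ G → Σ Graph λ H → Σ ℕ λ a → Σ ℕ λ b →
    (2 ≤ n G) × (2 ≤ n H) × Connected G × Connected H ×
    IsHullNumber G a × IsHullNumber H b × IsHullNumber (G ⊠ H) (a * b))
theorem2 = hullNumber-bounds , lower-bound-sharp , upper-bound-sharp
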